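{- Let $n,k\in\mathbb{N}$ with $n\ge3$, $k\ge2$, let $G=MC_n^k$, let $l\in\mathbb{N}$ and let $f,g$ be two lazy $l$-tracks on $G$. Then there exists $i\in\mathbb{N}_l$ such that $|p_2(f(i))-p_2(g(i))|\le 1$, i.e. $f(i)$ and $g(i)$ lie in the same or in adjacent layers.
   Context: For $n\ge3$, $k\ge2$, the multilayered cycle $MC_n^k$ is the graph with vertex set $\{(i,j): i\in\mathbb{Z}_n,\ j\in\{1,\dots,k\}\}$ in which $(a,b)$ and $(c,d)$ are adjacent iff either $a=c$ and $|d-b|=1$, or $b=d$ and $a-c\equiv\pm1 \pmod n$. The layer of vertex $(i,j)$ is $p_2(i,j)=j$. Write $\mathbb{N}_l=\{1,\dots,l\}$. A lazy $l$-track on a graph $G$ is a surjective map $f:\mathbb{N}_l\to V(G)$ with $f(i)f(i+1)\in E(G)$ or $f(i)=f(i+1)$ for all $i\in\mathbb{N}_{l-1}$. -}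

module Defs where

import Data.Nat.Properties
open import Data.Nat using (ℕ; zero; suc; _+_; _≤_; _<_; ∣_-_∣; NonZero)
open import Data.Nat.DivMod using (_%_)
open import Data.Fin using (Fin; toℕ; fromℕ<; inject₁) renaming (suc to fsuc)
open import Data.Product using (_×_; _,_; Σ; ∃; proj₁; proj₂)
open import Data.Sum using (_⊎_)
open import Relation.Binary.PropositionalEquality using (_≡_)

-- Vertices of MC_n^k: pairs (i , j) with i ∈ ℤ_n (as Fin n) and layer j ∈ {1..k}
-- represented as Fin k with layer number toℕ j + 1.
Vertex : ℕ → ℕ → Set
Vertex n k = Fin n × Fin k

p₂ : ∀ {n k} → Vertex n k → ℕ
p₂ (i , j) = suc (toℕ j)

cyc-adj : ∀ {n} → Fin n → Fin n → Set
cyc-adj {zero} () c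
cyc-adj {suc m} a c =
  (toℕ a ≡ (toℕ c + 1) % suc m) ⊎ (toℕ c ≡ (toℕ a + 1) % suc m)

Adj : ∀ {n k} → Vertex n k → Vertex n k → Set
Adj (a , b) (c , d) =
  (a ≡ c × ∣ toℕ d - toℕ b ∣ ≡ 1) ⊎ (b ≡ d × cyc-adj a c)

-- ℕ_l = {1,…,l} represented by Fin l (index i ↦ i+1).
-- A lazy l-track: surjective f with consecutive values equal or adjacent.
record LazyTrack (n k l : ℕ) : Set where
  field
    track      : Fin l → Vertex n k
    surjective : ∀ (v : Vertex n k) → ∃ λ i → track i ≡ v
    lazy-step  : ∀ (i : ℕ) (i+1<l : suc i < l) →
                   let x = track (fromℕ< {i} (Data.Nat.Properties.<-trans (Data.Nat.Properties.n<1+n i) i+1<l))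
                       y = track (fromℕ< i+1<l)
                   in Adj x y ⊎ x ≡ y

-- Follow the layers of f and g as two sequences of naturals moving by at most one per step, both
-- reaching the top layer (by surjectivity). Where f is on top it is not below g, and where g is
-- on top it is not below f, so by a discrete intermediate value argument the two sequences are
-- within distance one somewhere in between.
module Submission where

open import Defs
open import Data.Nat using (ℕ; zero; suc; _≤_; _<_; _≤′_; ≤′-refl; ≤′-step; _≤?_; _<?_; ∣_-_∣; z≤n; s≤s)
open import Data.Nat.Properties
  using (≤-refl; ≤-trans; <-trans; ≤-total; ≤-pred; ≤⇒≤′; n≤1+n; n<1+n; ≰⇒>; +-monoˡ-≤; m≤∣m-n∣+n; ∣-∣-comm)
open import Data.Fin using (Fin; toℕ; fromℕ; fromℕ<) renaming (zero to fzero)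
open import Data.Fin.Properties using (toℕ<n; fromℕ<-toℕ; toℕ-fromℕ)
open import Data.Product using (∃; _×_; _,_)
open import Data.Sum using (_⊎_; inj₁; inj₂)
open import Relation.Nullary using (¬_; yes; no; contradiction)
open import Relation.Binary.PropositionalEquality using (_≡_; refl; sym; trans; cong; subst; subst₂; module ≡-Reasoning)

Near : ℕ → ℕ → Set
Near x y = ∣ x - y ∣ ≤ 1

near-sym : ∀ {x y} → Near x y → Near y x
near-sym {x} {y} = subst (_≤ 1) (∣-∣-comm x y)

near⇒≤suc : ∀ {x y} → Near x y → x ≤ suc y
near⇒≤suc {x} {y} x≈y = ≤-trans (m≤∣m-n∣+n x y) (+-monoˡ-≤ y x≈y)

≤suc⇒near : ∀ {x y} → x ≤ suc y → y ≤ suc x → Near x y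
≤suc⇒near {zero}  {zero}  _         _         = z≤n
≤suc⇒near {zero}  {suc y} _         y≤1       = y≤1
≤suc⇒near {suc x} {zero}  x≤1       _         = x≤1
≤suc⇒near {suc x} {suc y} (s≤s x≤y) (s≤s y≤x) = ≤suc⇒near x≤y y≤x

near-refl : ∀ x → Near x x
near-refl x = ≤suc⇒near (n≤1+n x) (n≤1+n x)

≤-far-back : ∀ {x x' y y'} → Near x' x → Near y' y → x' ≤ y' → ¬ Near x' y' → x ≤ y
≤-far-back {x} {x'} {y} {y'} x'≈x y'≈y x'≤y' x'≉y' with y' ≤? suc x'
... | yes y'≤1+x' = contradiction (≤suc⇒near (≤-trans x'≤y' (n≤1+n y')) y'≤1+x') x'≉y'
... | no  y'≰1+x' = ≤-pred (≤-trans (s≤s (near⇒≤suc (near-sym {x'} x'≈x)))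
                                      (≤-trans (≰⇒> y'≰1+x') (near⇒≤suc y'≈y)))

UnitSteps : ℕ → (ℕ → ℕ) → Set
UnitSteps l u = ∀ i → suc i < l → Near (u (suc i)) (u i)

module _ {l : ℕ} where

  near-between : ∀ {u w a b} → UnitSteps l u → UnitSteps l w → a ≤′ b → b < l →
                 w a ≤ u a → u b ≤ w b → ∃ λ i → i < l × Near (u i) (w i)
  near-between {a = a} _ _ ≤′-refl a<l w≤u u≤w =
    a , a<l , ≤suc⇒near (≤-trans u≤w (n≤1+n _)) (≤-trans w≤u (n≤1+n _))
  near-between {u} {w} us ws (≤′-step {b} a≤′b) 1+b<l w≤u u≤w with ∣ u (suc b) - w (suc b) ∣ ≤? 1
  ... | yes near = suc b , 1+b<l , near
  ... | no  far  = near-between us ws a≤′b (<-trans (n<1+n b) 1+b<l) w≤u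
                     (≤-far-back (us b 1+b<l) (ws b 1+b<l) u≤w far)

  near-somewhere : ∀ {u w a b} → UnitSteps l u → UnitSteps l w → a < l → b < l →
                   w a ≤ u a → u b ≤ w b → ∃ λ i → i < l × Near (u i) (w i)
  near-somewhere {u} {w} {a} {b} us ws a<l b<l w≤u u≤w with ≤-total a b
  ... | inj₁ a≤b = near-between us ws (≤⇒≤′ a≤b) b<l w≤u u≤w
  ... | inj₂ b≤a with near-between ws us (≤⇒≤′ b≤a) a<l u≤w w≤u
  ...   | i , i<l , near = i , i<l , near-sym {w i} near

Adj⇒near-layers : ∀ {n k} {x y : Vertex n k} → Adj x y ⊎ x ≡ y → Near (p₂ y) (p₂ x)
Adj⇒near-layers (inj₁ (inj₁ (refl , layers-differ-by-1))) = subst (_≤ 1) (sym layers-differ-by-1) ≤-refl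
Adj⇒near-layers {x = _ , b} (inj₁ (inj₂ (refl , _))) = near-refl (suc (toℕ b))
Adj⇒near-layers {x = x} (inj₂ refl) = near-refl (p₂ x)

p₂≤ : ∀ {n k} (v : Vertex n k) → p₂ v ≤ k
p₂≤ (_ , j) = toℕ<n j

module _ {n k l : ℕ} (t : LazyTrack n k l) where
  open LazyTrack t

  -- Padded with 0 beyond index l, so that the layers form a sequence ℕ → ℕ.
  layers : ℕ → ℕ
  layers i with i <? l
  ... | yes i<l = p₂ (track (fromℕ< i<l))
  ... | no  _   = 0

  layers-fromℕ< : ∀ {i} (i<l : i < l) → layers i ≡ p₂ (track (fromℕ< i<l))
  layers-fromℕ< {i} i<l with i <? l
  ... | yes _   = refl
  ... | no  i≮l = contradiction i<l i≮l

  layers-unitSteps : UnitSteps l layers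
  layers-unitSteps i 1+i<l
    rewrite layers-fromℕ< 1+i<l | layers-fromℕ< (<-trans (n<1+n i) 1+i<l) =
    Adj⇒near-layers (lazy-step i 1+i<l)

  layers≤ : ∀ i → layers i ≤ k
  layers≤ i with i <? l
  ... | yes i<l = p₂≤ (track (fromℕ< i<l))
  ... | no  _   = z≤n

  layers-reaches : ∀ v → ∃ λ a → a < l × layers a ≡ p₂ v
  layers-reaches v with surjective v
  ... | a , track-a≡v = toℕ a , toℕ<n a , (begin
    layers (toℕ a)                    ≡⟨ layers-fromℕ< (toℕ<n a) ⟩
    p₂ (track (fromℕ< (toℕ<n a)))     ≡⟨ cong (λ j → p₂ (track j)) (fromℕ<-toℕ a (toℕ<n a)) ⟩
    p₂ (track a)                      ≡⟨ cong p₂ track-a≡v ⟩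
    p₂ v                              ∎)
    where open ≡-Reasoning

layers-reaches-top : ∀ {n k l} (t : LazyTrack (suc n) (suc k) l) → ∃ λ a → a < l × layers t a ≡ suc k
layers-reaches-top {n} {k} t with layers-reaches t (fzero {n} , fromℕ k)
... | a , a<l , top = a , a<l , trans top (cong suc (toℕ-fromℕ k))

lazyTracks-near : ∀ {n k l} (f g : LazyTrack (suc n) (suc k) l) →
                  ∃ λ (i : Fin l) → Near (p₂ (LazyTrack.track f i)) (p₂ (LazyTrack.track g i))
lazyTracks-near f g with layers-reaches-top f | layers-reaches-top g
... | a , a<l , f-top | b , b<l , g-top
  with near-somewhere (layers-unitSteps f) (layers-unitSteps g) a<l b<l
         (subst (layers g a ≤_) (sym f-top) (layers≤ g a)) (subst (layers f b ≤_) (sym g-top) (layers≤ f b))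
...  | i , i<l , near = fromℕ< i<l , subst₂ Near (layers-fromℕ< f i<l) (layers-fromℕ< g i<l) near

lemma3 : (n k : ℕ) → 3 ≤ n → 2 ≤ k → (l : ℕ) → (f g : LazyTrack n k l) →
    ∃ λ (i : Fin l) →
    ∣ p₂ (LazyTrack.track f i) - p₂ (LazyTrack.track g i) ∣ ≤ 1
-- The bounds on n and k are only used to make the vertex set, hence the top layer, nonempty.
lemma3 (suc _) (suc _) _ _ _ f g = lazyTracks-near f g
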